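{- Let $G$ be a finite connected graph with at least one edge, $\Delta$ a decision tree for $G$, and $S,S'$ two subgraphs of $G$. The following are equivalent: (i) $S$ and $S'$ have the same history; (ii) $S$ and $S'$ induce the same partition of $E(G)$ into edges of types $\mathbf S_e,\mathbf L,\mathbf S_i,\mathbf I$ (each edge having the same type for $S$ and $S'$); (iii) $S$ and $S'$ have the same set of edges of type $\mathbf S_e$ and the same set of edges of type $\mathbf S_i$; (iv) $S\,\triangle\,S'\subseteq\mathrm{Act}(S)$; (v) there exists $R\subseteq\mathrm{Act}(S)$ with $S'=S\,\triangle\,R$. Here $\triangle$ denotes symmetric difference.
   Context: Graphs are finite, loops and multiple edges allowed; $m=|E(G)|$. Subgraphs are spanning, identified with edge sets. An isthmus is an edge whose deletion increases the number of connected components; an edge is standard if neither a loop nor an isthmus. A decision tree for $G$ is a perfect binary tree with all leaves at depth $m-1$ (root at depth $0$), each node labelled by an edge, such that along every root-to-leaf path the labels form a permutation of $E(G)$. Given a subgraph $S$: set $H:=G$, $n:=$ root of $\Delta$; for $k=1,\dots,m$ let $e_k$ be the label of $n$ and do exactly one of: (i) if $e_k$ is standard in $H$ and $e_k\notin S$: type $\mathbf S_e$, $H:=H\setminus e_k$ (deletion), $n:=$ left child; (ii) if $e_k$ is a loop of $H$: type $\mathbf L$, $H:=H\setminus e_k$, $n:=$ left child; (iii) if $e_k$ is standard in $H$ and $e_k\in S$: type $\mathbf S_i$, $H:=H/e_k$ (contraction), $n:=$ right child; (iv) if $e_k$ is an isthmus of $H$: type $\mathbf I$, $H:=H/e_k$,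 $n:=$ right child. $\mathrm{Act}(S)$ is the set of edges of type $\mathbf L$ or $\mathbf I$ for $S$. The history of $S$ is the sequence $(e_1,t_1),\dots,(e_m,t_m)$, $t_k$ the type of $e_k$. -}

module Defs where

open import Data.Nat using (ℕ; zero; suc; _<_; _≥_)
open import Data.Fin using (Fin; _≟_)
open import Data.Fin.Subset using (Subset; _∈_; _∉_; _∪_; _─_)
open import Data.Bool using (Bool; true; false)
open import Data.Product using (Σ; _×_; _,_; proj₁; proj₂)
open import Data.Sum using (_⊎_)
open import Data.List using (List; []; _∷_; map; _++_; [_])
open import Data.List.Membership.Propositional using () renaming (_∈_ to _∈ₗ_)
open import Data.List.Relation.Unary.All using (All)
open import Data.List.Relation.Binary.Permutation.Propositional using (_↭_)
open import Data.List using (allFin)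
open import Relation.Nullary using (¬_; yes; no)
open import Relation.Binary.PropositionalEquality using (_≡_)
open import Function.Definitions using (Surjective)
open import Function.Bundles using (_⇔_)

-- Finite multigraphs (loops and multiple edges allowed):
-- vertex set Fin n, edge set Fin m, each edge has two ends.

record Graph : Set where
  field
    nV   : ℕ
    nE   : ℕ
    ends : Fin nE → Fin nV × Fin nV
open Graph public

-- Minors of a fixed graph G obtained by deletions/contractions.
-- The edge labels stay those of G (Fin (nE G)); `present` marks edges
-- not yet deleted/contracted.  Contraction of an edge with ends (u , v)
-- identifies v with u (v is renamed to u everywhere and becomes an
-- isolated vertex).

module _ (G : Graph) where

  record Minor : Set where
    field
      present : Fin (nE G) → Bool
      mends   : Fin (nE G) → Fin (nV G) × Fin (nV G)
  open Minor public

  initial : Minor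
  initial = record { present = λ _ → true ; mends = ends G }

  remove : Fin (nE G) → (Fin (nE G) → Bool) → Fin (nE G) → Bool
  remove e p f with f ≟ e
  ... | yes _ = false
  ... | no  _ = p f

  delete : Fin (nE G) → Minor → Minor
  delete e H = record { present = remove e (present H) ; mends = mends H }

  rename : Fin (nV G) → Fin (nV G) → Fin (nV G) → Fin (nV G)
  rename v u w with w ≟ v
  ... | yes _ = u
  ... | no  _ = w

  contract : Fin (nE G) → Minor → Minor
  contract e H = record
    { present = remove e (present H)
    ; mends   = λ f → rename v u (proj₁ (mends H f)) , rename v u (proj₂ (mends H f)) }
    where
      u = proj₁ (mends H e)
      v = proj₂ (mends H e)

  data Reach (H : Minor) : Fin (nV G) → Fin (nV G) → Set where
    here : ∀ {x} → Reach H x x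
    fwd  : ∀ {x z} (f : Fin (nE G)) → present H f ≡ true →
           proj₁ (mends H f) ≡ x → Reach H (proj₂ (mends H f)) z → Reach H x z
    bwd  : ∀ {x z} (f : Fin (nE G)) → present H f ≡ true →
           proj₂ (mends H f) ≡ x → Reach H (proj₁ (mends H f)) z → Reach H x z

  NumComponents : Minor → ℕ → Set
  NumComponents H k =
    Σ (Fin (nV G) → Fin k) λ c →
      Surjective _≡_ _≡_ c × (∀ x y → (c x ≡ c y) ⇔ Reach H x y)

  IsEdge : Minor → Fin (nE G) → Set
  IsEdge H e = present H e ≡ true

  IsLoop : Minor → Fin (nE G) → Set
  IsLoop H e = IsEdge H e × (proj₁ (mends H e) ≡ proj₂ (mends H e))

  IsIsthmus : Minor → Fin (nE G) → Set
  IsIsthmus H e = IsEdge H e ×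
    Σ ℕ λ k → Σ ℕ λ k' → NumComponents H k × NumComponents (delete e H) k' × k < k'

  IsStandard : Minor → Fin (nE G) → Set
  IsStandard H e = IsEdge H e × ¬ IsLoop H e × ¬ IsIsthmus H e

  ConnectedGraph : Set
  ConnectedGraph = ∀ x y → Reach initial x y

-- Decision trees: perfect binary trees with k levels of edge-labelled
-- nodes (tip = below a leaf).  A decision tree for G has nE G levels,
-- i.e. leaves at depth nE G - 1.

data BTree (m : ℕ) : ℕ → Set where
  tip  : BTree m zero
  node : ∀ {k} → Fin m → BTree m k → BTree m k → BTree m (suc k)

paths : ∀ {m k} → BTree m k → List (List (Fin m))
paths tip = [ [] ]
paths (node e l r) = map (e ∷_) (paths l ++ paths r)

IsDecisionTree : (G : Graph) → BTree (nE G) (nE G) → Set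
IsDecisionTree G Δ = All (λ p → p ↭ allFin (nE G)) (paths Δ)

data EdgeType : Set where
  Se L Si I : EdgeType

module _ (G : Graph) where

  data Run : ∀ {k} → BTree (nE G) k → Minor G → Subset (nE G) →
             List (Fin (nE G) × EdgeType) → Set where
    done : ∀ {H S} → Run tip H S []
    runSe : ∀ {k e} {l r : BTree (nE G) k} {H S h} →
            IsStandard G H e → e ∉ S → Run l (delete G e H) S h →
            Run (node e l r) H S ((e , Se) ∷ h)
    runL  : ∀ {k e} {l r : BTree (nE G) k} {H S h} →
            IsLoop G H e → Run l (delete G e H) S h →
            Run (node e l r) H S ((e , L) ∷ h)
    runSi : ∀ {k e} {l r : BTree (nE G) k} {H S h} →
            IsStandard G H e → e ∈ S → Run r (contract G e H) S h →
            Run (node e l r) H S ((e , Si) ∷ h)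
    runI  : ∀ {k e} {l r : BTree (nE G) k} {H S h} →
            IsIsthmus G H e → Run r (contract G e H) S h →
            Run (node e l r) H S ((e , I) ∷ h)

  HistoryOf : BTree (nE G) (nE G) → Subset (nE G) → List (Fin (nE G) × EdgeType) → Set
  HistoryOf Δ S h = Run Δ (initial G) S h

  HasType : BTree (nE G) (nE G) → Subset (nE G) → Fin (nE G) → EdgeType → Set
  HasType Δ S e t = Σ (List (Fin (nE G) × EdgeType)) λ h → HistoryOf Δ S h × ((e , t) ∈ₗ h)

  InAct : BTree (nE G) (nE G) → Subset (nE G) → Fin (nE G) → Set
  InAct Δ S e = HasType Δ S e L ⊎ HasType Δ S e I

_△_ : ∀ {m} → Subset m → Subset m → Subset m
S △ T = (S ─ T) ∪ (T ─ S)

-- The heart of the argument is that the run of the algorithm is a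
-- well-defined function of S: a history exists (every test the
-- algorithm performs is decidable) and is unique (the four cases are
-- mutually exclusive), and S is consulted only at Se/Si steps.  Hence
-- a history of S is a history of S' as soon as S' agrees with S on the
-- Se and Si edges, and since the edges of a history are a permutation
-- of E(G), every edge has exactly one type.

module Submission where

open import Defs
open import Data.Nat using (ℕ; zero; suc; _<_; _≤_; _≥_)
open import Data.Nat.Properties using (≤-antisym; <⇒≱; _<?_)
open import Data.Fin using (Fin; zero; suc; _≟_)
open import Data.Fin.Properties using (any?; suc-injective; injective⇒≤)
open import Data.Fin.Subset using (Subset; _∈_; _∉_; _∪_; _─_; inside; outside)
open import Data.Fin.Subset.Properties using (_∈?_; x∈p∪q⁻; x∈p∪q⁺; x∈p∧x∉q⇒x∈p─q)
open import Data.Vec using ([]; _∷_; here; there)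
open import Data.Bool using (true; false)
import Data.Bool.Properties as Bool
open import Data.Product using (Σ; _×_; _,_; proj₁; proj₂; ∃)
open import Data.Sum using (_⊎_; inj₁; inj₂)
open import Data.Unit using (⊤; tt)
open import Data.Empty using (⊥-elim)
open import Data.List using (List; []; _∷_; map; _++_; allFin)
open import Data.List.Membership.Propositional using () renaming (_∈_ to _∈ₗ_)
open import Data.List.Membership.Propositional.Properties
  using (∈-map⁺; ∈-map⁻; ∈-++⁺ˡ; ∈-++⁺ʳ; ∈-allFin)
open import Data.List.Relation.Unary.Any using (here; there)
open import Data.List.Relation.Unary.All as All using (All; _∷_)
import Data.List.Relation.Unary.All.Properties as All
open import Data.List.Relation.Unary.AllPairs using (_∷_)
open import Data.List.Relation.Unary.Unique.Propositional using (Unique)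
open import Data.List.Relation.Unary.Unique.Propositional.Properties using (allFin⁺)
open import Data.List.Relation.Binary.Permutation.Propositional using (_↭_; ↭-sym; ↭⇒↭ₛ)
open import Data.List.Relation.Binary.Permutation.Propositional.Properties using (∈-resp-↭)
import Data.List.Relation.Binary.Permutation.Setoid.Properties as Perm
open import Relation.Nullary using (¬_; Dec; yes; no)
open import Relation.Nullary.Decidable using (_×-dec_; _⊎-dec_; map′)
open import Relation.Binary.Definitions using (Decidable)
open import Relation.Binary.Structures using (IsDecEquivalence)
open import Relation.Binary.Construct.Closure.ReflexiveTransitive
  using (Star; ε; _◅_; _◅◅_; reverse)
open import Relation.Binary.PropositionalEquality
open import Function.Definitions using (Surjective)
open import Function.Bundles using (_⇔_; mk⇔; Equivalence)
open Equivalence using (to; from)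
open import Function using (_∘_)

-- Eliminating vertex 0 of a graph on Fin (suc n): walks between the
-- remaining vertices correspond to walks in the graph E₀ on Fin n in
-- which a detour a → 0 → b counts as a single edge.
module EliminateZero {n : ℕ} (E : Fin (suc n) → Fin (suc n) → Set) where

  E₀ : Fin n → Fin n → Set
  E₀ a b = E (suc a) (suc b) ⊎ (E (suc a) zero × E zero (suc b))

  -- the shape of a walk from x to z once its visits to 0 are contracted
  Via : Fin (suc n) → Fin (suc n) → Set
  Via zero    zero    = ⊤
  Via zero    (suc b) = ∃ λ c → E zero (suc c) × Star E₀ c b
  Via (suc a) zero    = ∃ λ c → Star E₀ a c × E (suc c) zero
  Via (suc a) (suc b) = Star E₀ a b

  prepend : ∀ x w z → E x w → Via w z → Via x z
  prepend zero    zero    z       _ v             = v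
  prepend zero    (suc c) zero    _ _             = tt
  prepend zero    (suc c) (suc b) e v             = c , e , v
  prepend (suc a) zero    zero    e _             = a , ε , e
  prepend (suc a) zero    (suc b) e (c , e′ , v)  = inj₂ (e , e′) ◅ v
  prepend (suc a) (suc c) zero    e (d , v , e′)  = d , inj₁ e ◅ v , e′
  prepend (suc a) (suc c) (suc b) e v             = inj₁ e ◅ v

  contractWalk : ∀ {x z} → Star E x z → Via x z
  contractWalk {zero}  ε = tt
  contractWalk {suc a} ε = ε
  contractWalk {x} {z} (_◅_ {j = w} e p) = prepend x w z e (contractWalk p)

  expand : ∀ {a b} → Star E₀ a b → Star E (suc a) (suc b)
  expand ε                     = ε
  expand (inj₁ e ◅ p)          = e ◅ expand p
  expand (inj₂ (e , e′) ◅ p)   = e ◅ e′ ◅ expand p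

  expandWalk : ∀ x z → Via x z → Star E x z
  expandWalk zero    zero    _           = ε
  expandWalk zero    (suc b) (c , e , v) = e ◅ expand v
  expandWalk (suc a) zero    (c , v , e) = expand v ◅◅ (e ◅ ε)
  expandWalk (suc a) (suc b) v           = expand v

decStar : ∀ {n} (E : Fin n → Fin n → Set) → Decidable E → Decidable (Star E)
decStar {zero}  E dec ()
decStar {suc n} E dec x z = map′ (expandWalk x z) contractWalk (decVia x z)
  where
  open EliminateZero E
  decStar₀ : Decidable (Star E₀)
  decStar₀ = decStar E₀ λ a b → dec (suc a) (suc b) ⊎-dec (dec (suc a) zero ×-dec dec zero (suc b))
  decVia : ∀ x z → Dec (Via x z)
  decVia zero    zero    = yes tt
  decVia zero    (suc b) = any? λ c → dec zero (suc c) ×-dec decStar₀ c b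
  decVia (suc a) zero    = any? λ c → decStar₀ a c ×-dec dec (suc c) zero
  decVia (suc a) (suc b) = decStar₀ a b

Classes : ∀ n → (Fin n → Fin n → Set) → ℕ → Set
Classes n R k = Σ (Fin n → Fin k) λ c → Surjective _≡_ _≡_ c × (∀ x y → (c x ≡ c y) ⇔ R x y)

-- a decidable equivalence relation on Fin n has finitely many classes:
-- vertex 0 either joins the class of some later vertex or opens a new one
classes : ∀ n {R : Fin n → Fin n → Set} → IsDecEquivalence R → ∃ (Classes n R)
classes zero    _  = zero , (λ ()) , (λ ()) , (λ ())
classes (suc n) {R} isDE
  with classes n {λ a b → R (suc a) (suc b)} restricted | any? (λ a → zero ≟R suc a)
  where
  open IsDecEquivalence isDE
    renaming (_≟_ to _≟R_; refl to R-refl; sym to R-sym; trans to R-trans)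
  restricted : IsDecEquivalence (λ a b → R (suc a) (suc b))
  restricted = record
    { isEquivalence = record { refl = R-refl ; sym = R-sym ; trans = R-trans }
    ; _≟_ = λ a b → suc a ≟R suc b }
... | k , c , surj , fib | yes (a₀ , R0a₀) = k , c′ , surj′ , fib′
  where
  open IsDecEquivalence isDE renaming (refl to R-refl; sym to R-sym; trans to R-trans)
  c′ : Fin (suc n) → Fin k
  c′ zero    = c a₀
  c′ (suc a) = c a
  surj′ : Surjective _≡_ _≡_ c′
  surj′ y = suc (proj₁ (surj y)) , λ { refl → proj₂ (surj y) refl }
  fib′ : ∀ x y → (c′ x ≡ c′ y) ⇔ R x y
  fib′ zero    zero    = mk⇔ (λ _ → R-refl) (λ _ → refl)
  fib′ zero    (suc b) = mk⇔ (λ e → R-trans R0a₀ (to (fib a₀ b) e))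
                             (λ r → from (fib a₀ b) (R-trans (R-sym R0a₀) r))
  fib′ (suc a) zero    = mk⇔ (λ e → R-trans (to (fib a a₀) e) (R-sym R0a₀))
                             (λ r → from (fib a a₀) (R-trans r R0a₀))
  fib′ (suc a) (suc b) = fib a b
... | k , c , surj , fib | no ¬R0 = suc k , c′ , surj′ , fib′
  where
  open IsDecEquivalence isDE renaming (refl to R-refl; sym to R-sym)
  c′ : Fin (suc n) → Fin (suc k)
  c′ zero    = zero
  c′ (suc a) = suc (c a)
  surj′ : Surjective _≡_ _≡_ c′
  surj′ zero    = zero , λ { refl → refl }
  surj′ (suc y) = suc (proj₁ (surj y)) , λ { refl → cong suc (proj₂ (surj y) refl) }
  fib′ : ∀ x y → (c′ x ≡ c′ y) ⇔ R x y
  fib′ zero    zero    = mk⇔ (λ _ → R-refl) (λ _ → refl)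
  fib′ zero    (suc b) = mk⇔ (λ ()) (λ r → ⊥-elim (¬R0 (b , r)))
  fib′ (suc a) zero    = mk⇔ (λ ()) (λ r → ⊥-elim (¬R0 (a , R-sym r)))
  fib′ (suc a) (suc b) = mk⇔ (λ e → to (fib a b) (suc-injective e))
                             (λ r → cong suc (from (fib a b) r))

-- a finer relation has at least as many classes: choosing a
-- representative of each R-class and taking its R′-class is injective
classes-mono : ∀ {n} {R R′ : Fin n → Fin n → Set} {k k′} →
               Classes n R k → Classes n R′ k′ → (∀ x y → R′ x y → R x y) → k ≤ k′
classes-mono {n} {k = k} (c , surj , fib) (c′ , _ , fib′) finer = injective⇒≤ injective
  where
  rep : Fin k → Fin n
  rep y = proj₁ (surj y)
  rep-ok : ∀ y → c (rep y) ≡ y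
  rep-ok y = proj₂ (surj y) refl
  injective : ∀ {y₁ y₂} → c′ (rep y₁) ≡ c′ (rep y₂) → y₁ ≡ y₂
  injective {y₁} {y₂} eq = begin
    y₁             ≡⟨ sym (rep-ok y₁) ⟩
    c (rep y₁)     ≡⟨ from (fib _ _) (finer _ _ (to (fib′ _ _) eq)) ⟩
    c (rep y₂)     ≡⟨ rep-ok y₂ ⟩
    y₂             ∎
    where open ≡-Reasoning

module Minors (G : Graph) where

  Vertex = Fin (nV G)
  Edge   = Fin (nE G)

  remove-other : ∀ e p f → ¬ f ≡ e → remove G e p f ≡ p f
  remove-other e p f f≢e with f ≟ e
  ... | yes f≡e = ⊥-elim (f≢e f≡e)
  ... | no  _   = refl

  Adj : Minor G → Vertex → Vertex → Set
  Adj H a b = ∃ λ f → present H f ≡ true ×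
    ((proj₁ (mends H f) ≡ a × proj₂ (mends H f) ≡ b) ⊎
     (proj₂ (mends H f) ≡ a × proj₁ (mends H f) ≡ b))

  decAdj : ∀ H → Decidable (Adj H)
  decAdj H a b = any? λ f → (present H f Bool.≟ true) ×-dec
    (((proj₁ (mends H f) ≟ a) ×-dec (proj₂ (mends H f) ≟ b)) ⊎-dec
     ((proj₂ (mends H f) ≟ a) ×-dec (proj₁ (mends H f) ≟ b)))

  Adj-sym : ∀ {H a b} → Adj H a b → Adj H b a
  Adj-sym (f , p , inj₁ (e₁ , e₂)) = f , p , inj₂ (e₂ , e₁)
  Adj-sym (f , p , inj₂ (e₁ , e₂)) = f , p , inj₁ (e₂ , e₁)

  reach⇒star : ∀ {H x y} → Reach G H x y → Star (Adj H) x y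
  reach⇒star here          = ε
  reach⇒star (fwd f p e r) = (f , p , inj₁ (e , refl)) ◅ reach⇒star r
  reach⇒star (bwd f p e r) = (f , p , inj₂ (e , refl)) ◅ reach⇒star r

  star⇒reach : ∀ {H x y} → Star (Adj H) x y → Reach G H x y
  star⇒reach ε                                 = here
  star⇒reach ((f , p , inj₁ (e , refl)) ◅ w)   = fwd f p e (star⇒reach w)
  star⇒reach ((f , p , inj₂ (e , refl)) ◅ w)   = bwd f p e (star⇒reach w)

  Reach-isDecEquivalence : ∀ H → IsDecEquivalence (Reach G H)
  Reach-isDecEquivalence H = record
    { isEquivalence = record
      { refl  = here
      ; sym   = λ r → star⇒reach (reverse Adj-sym (reach⇒star r))
      ; trans = λ r s → star⇒reach (reach⇒star r ◅◅ reach⇒star s) }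
    ; _≟_ = λ x y → map′ star⇒reach reach⇒star (decStar (Adj H) (decAdj H) x y) }

  numComponents : ∀ H → ∃ (NumComponents G H)
  numComponents H = classes (nV G) (Reach-isDecEquivalence H)

  numComponents-unique : ∀ {H k k′} → NumComponents G H k → NumComponents G H k′ → k ≡ k′
  numComponents-unique N N′ =
    ≤-antisym (classes-mono N N′ (λ _ _ r → r)) (classes-mono N′ N (λ _ _ r → r))

  reach-delete-loop : ∀ {e H x y} → IsLoop G H e → Reach G H x y → Reach G (delete G e H) x y
  reach-delete-loop lp here = here
  reach-delete-loop {e} {H} lp (fwd f p q r) with f ≟ e
  ... | yes refl = subst (λ w → Reach G (delete G e H) w _) (trans (sym (proj₂ lp)) q)
                         (reach-delete-loop lp r)
  ... | no f≢e   = fwd f (trans (remove-other e (present H) f f≢e) p) q (reach-delete-loop lp r)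
  reach-delete-loop {e} {H} lp (bwd f p q r) with f ≟ e
  ... | yes refl = subst (λ w → Reach G (delete G e H) w _) (trans (proj₂ lp) q)
                         (reach-delete-loop lp r)
  ... | no f≢e   = bwd f (trans (remove-other e (present H) f f≢e) p) q (reach-delete-loop lp r)

  loop⇒¬isthmus : ∀ {H e} → IsLoop G H e → ¬ IsIsthmus G H e
  loop⇒¬isthmus lp (_ , _ , _ , N , N′ , k<k′) =
    <⇒≱ k<k′ (classes-mono N′ N (λ _ _ r → reach-delete-loop lp r))

  isthmus? : ∀ H e → IsEdge G H e → Dec (IsIsthmus G H e)
  isthmus? H e isEdge with numComponents H | numComponents (delete G e H)
  ... | k , N | k′ , N′ with k <? k′
  ... | yes k<k′ = yes (isEdge , k , k′ , N , N′ , k<k′)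
  ... | no  k≮k′ = no λ { (_ , _ , _ , N₁ , N₁′ , lt) →
          k≮k′ (subst₂ _<_ (numComponents-unique N₁ N) (numComponents-unique N₁′ N′) lt) }

module Runs (G : Graph) where

  open Minors G

  History = List (Edge × EdgeType)

  -- every root-to-leaf label sequence of t is duplicate-free and
  -- consists of edges present in H: the invariant under which the
  -- algorithm never gets stuck
  record Admissible {k} (t : BTree (nE G) k) (H : Minor G) : Set where
    constructor admissible
    field paths-ok : All (λ q → Unique q × All (IsEdge G H) q) (paths t)

  leftmost : ∀ {k} (t : BTree (nE G) k) → ∃ λ q → q ∈ₗ paths t
  leftmost tip          = [] , here refl
  leftmost (node e l r) = e ∷ proj₁ (leftmost l) , ∈-map⁺ (e ∷_) (∈-++⁺ˡ (proj₂ (leftmost l)))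

  root-present : ∀ {k e H} {l r : BTree (nE G) k} → Admissible (node e l r) H → IsEdge G H e
  root-present {l = l} {r} (admissible adm) with All.lookup adm (proj₂ (leftmost (node _ l r)))
  ... | _ , (isEdge ∷ _) = isEdge

  -- after processing e, the remaining path suffixes still consist of
  -- present edges, since e does not occur again on them
  admissible-tails : ∀ e H qs → All (λ q → Unique q × All (IsEdge G H) q) (map (e ∷_) qs) →
    All (λ q → Unique q × All (λ f → remove G e (present H) f ≡ true) q) qs
  admissible-tails e H _ adm = All.map tail (All.map⁻ adm)
    where
    tail : ∀ {q} → Unique (e ∷ q) × All (IsEdge G H) (e ∷ q) →
           Unique q × All (λ f → remove G e (present H) f ≡ true) q
    tail ((e∉q ∷ uq) , (_ ∷ present-q)) =
      uq , All.zipWith (λ (f≢e , p) → trans (remove-other e (present H) _ (f≢e ∘ sym)) p)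
                       (e∉q , present-q)

  admissible-left : ∀ {k e H} {l r : BTree (nE G) k} →
                    Admissible (node e l r) H → Admissible l (delete G e H)
  admissible-left {e = e} {H} {l} {r} (admissible adm) =
    admissible (All.++⁻ˡ (paths l) (admissible-tails e H (paths l ++ paths r) adm))

  admissible-right : ∀ {k e H} {l r : BTree (nE G) k} →
                     Admissible (node e l r) H → Admissible r (contract G e H)
  admissible-right {e = e} {H} {l} {r} (admissible adm) =
    admissible (All.++⁻ʳ (paths l) (admissible-tails e H (paths l ++ paths r) adm))

  -- every subgraph has a history: each case test is decidable
  run-exists : ∀ {k} (t : BTree (nE G) k) H S → Admissible t H → ∃ (Run G t H S)
  run-exists tip H S _ = [] , done
  run-exists (node e l r) H S adm
    with root-present adm | proj₁ (mends H e) ≟ proj₂ (mends H e)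
  ... | isEdge | yes ends≡ =
    let h , run = run-exists l (delete G e H) S (admissible-left adm)
    in (e , L) ∷ h , runL (isEdge , ends≡) run
  ... | isEdge | no ends≢ with isthmus? H e isEdge
  ... | yes isth =
    let h , run = run-exists r (contract G e H) S (admissible-right adm)
    in (e , I) ∷ h , runI isth run
  ... | no ¬isth with e ∈? S
  ... | yes e∈S =
    let h , run = run-exists r (contract G e H) S (admissible-right adm)
    in (e , Si) ∷ h , runSi (isEdge , (λ lp → ends≢ (proj₂ lp)) , ¬isth) e∈S run
  ... | no e∉S =
    let h , run = run-exists l (delete G e H) S (admissible-left adm)
    in (e , Se) ∷ h , runSe (isEdge , (λ lp → ends≢ (proj₂ lp)) , ¬isth) e∉S run

  -- the four cases are mutually exclusive, so the history is unique
  run-unique : ∀ {k} {t : BTree (nE G) k} {H S h₁ h₂} →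
               Run G t H S h₁ → Run G t H S h₂ → h₁ ≡ h₂
  run-unique done              done              = refl
  run-unique (runSe _ _ x)     (runSe _ _ y)     = cong (_ ∷_) (run-unique x y)
  run-unique (runL _ x)        (runL _ y)        = cong (_ ∷_) (run-unique x y)
  run-unique (runSi _ _ x)     (runSi _ _ y)     = cong (_ ∷_) (run-unique x y)
  run-unique (runI _ x)        (runI _ y)        = cong (_ ∷_) (run-unique x y)
  run-unique (runSe _ e∉S _)   (runSi _ e∈S _)   = ⊥-elim (e∉S e∈S)
  run-unique (runSi _ e∈S _)   (runSe _ e∉S _)   = ⊥-elim (e∉S e∈S)
  run-unique (runSe st _ _)    (runL lp _)       = ⊥-elim (proj₁ (proj₂ st) lp)
  run-unique (runL lp _)       (runSe st _ _)    = ⊥-elim (proj₁ (proj₂ st) lp)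
  run-unique (runSi st _ _)    (runL lp _)       = ⊥-elim (proj₁ (proj₂ st) lp)
  run-unique (runL lp _)       (runSi st _ _)    = ⊥-elim (proj₁ (proj₂ st) lp)
  run-unique (runSe st _ _)    (runI isth _)     = ⊥-elim (proj₂ (proj₂ st) isth)
  run-unique (runI isth _)     (runSe st _ _)    = ⊥-elim (proj₂ (proj₂ st) isth)
  run-unique (runSi st _ _)    (runI isth _)     = ⊥-elim (proj₂ (proj₂ st) isth)
  run-unique (runI isth _)     (runSi st _ _)    = ⊥-elim (proj₂ (proj₂ st) isth)
  run-unique (runL lp _)       (runI isth _)     = ⊥-elim (loop⇒¬isthmus lp isth)
  run-unique (runI isth _)     (runL lp _)       = ⊥-elim (loop⇒¬isthmus lp isth)

  Se⇒∉ : ∀ {k} {t : BTree (nE G) k} {H S h e} → Run G t H S h → (e , Se) ∈ₗ h → e ∉ S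
  Se⇒∉ (runSe _ e∉S _) (here refl) = e∉S
  Se⇒∉ (runSe _ _ x)   (there m)   = Se⇒∉ x m
  Se⇒∉ (runL _ x)      (there m)   = Se⇒∉ x m
  Se⇒∉ (runSi _ _ x)   (there m)   = Se⇒∉ x m
  Se⇒∉ (runI _ x)      (there m)   = Se⇒∉ x m

  Si⇒∈ : ∀ {k} {t : BTree (nE G) k} {H S h e} → Run G t H S h → (e , Si) ∈ₗ h → e ∈ S
  Si⇒∈ (runSi _ e∈S _) (here refl) = e∈S
  Si⇒∈ (runSe _ _ x)   (there m)   = Si⇒∈ x m
  Si⇒∈ (runL _ x)      (there m)   = Si⇒∈ x m
  Si⇒∈ (runSi _ _ x)   (there m)   = Si⇒∈ x m
  Si⇒∈ (runI _ x)      (there m)   = Si⇒∈ x m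

  -- S is consulted only at Se and Si steps: a run for S is a run for
  -- every S′ that agrees with S on these edges
  run-transfer : ∀ {k} {t : BTree (nE G) k} {H S S′ h} → Run G t H S h →
    (∀ e → (e , Se) ∈ₗ h → e ∉ S′) → (∀ e → (e , Si) ∈ₗ h → e ∈ S′) → Run G t H S′ h
  run-transfer done            _  _  = done
  run-transfer (runSe st _ x)  se si =
    runSe st (se _ (here refl)) (run-transfer x (λ e → se e ∘ there) (λ e → si e ∘ there))
  run-transfer (runL lp x)     se si =
    runL lp (run-transfer x (λ e → se e ∘ there) (λ e → si e ∘ there))
  run-transfer (runSi st _ x)  se si =
    runSi st (si _ (here refl)) (run-transfer x (λ e → se e ∘ there) (λ e → si e ∘ there))
  run-transfer (runI isth x)   se si =
    runI isth (run-transfer x (λ e → se e ∘ there) (λ e → si e ∘ there))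

  run-path : ∀ {k} {t : BTree (nE G) k} {H S h} → Run G t H S h → map proj₁ h ∈ₗ paths t
  run-path done                         = here refl
  run-path (runSe {e = e} _ _ x)        = ∈-map⁺ (e ∷_) (∈-++⁺ˡ (run-path x))
  run-path (runL {e = e} _ x)           = ∈-map⁺ (e ∷_) (∈-++⁺ˡ (run-path x))
  run-path (runSi {e = e} {l} _ _ x)    = ∈-map⁺ (e ∷_) (∈-++⁺ʳ (paths l) (run-path x))
  run-path (runI {e = e} {l} _ x)       = ∈-map⁺ (e ∷_) (∈-++⁺ʳ (paths l) (run-path x))

module Histories (G : Graph) (Δ : BTree (nE G) (nE G)) (isDT : IsDecisionTree G Δ) where

  open Minors G
  open Runs G

  permutation⇒unique : ∀ {q} → q ↭ allFin (nE G) → Unique q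
  permutation⇒unique q↭ =
    Perm.Unique-resp-↭ (setoid Edge) (↭⇒↭ₛ (↭-sym q↭)) (allFin⁺ (nE G))

  history-exists : ∀ S → ∃ (HistoryOf G Δ S)
  history-exists S = run-exists Δ (initial G) S
    (admissible (All.map (λ q↭ → permutation⇒unique q↭ , All.universal (λ _ → refl) _) isDT))

  history-permutation : ∀ {S h} → HistoryOf G Δ S h → map proj₁ h ↭ allFin (nE G)
  history-permutation run = All.lookup isDT (run-path run)

  type-exists : ∀ {S h} → HistoryOf G Δ S h → ∀ e → ∃ λ t → (e , t) ∈ₗ h
  type-exists run e
    with ∈-map⁻ proj₁ (∈-resp-↭ (↭-sym (history-permutation run)) (∈-allFin e))
  ... | (_ , t) , m , refl = t , m

  type-unique : ∀ {S h e t₁ t₂} → HistoryOf G Δ S h → (e , t₁) ∈ₗ h → (e , t₂) ∈ₗ h → t₁ ≡ t₂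
  type-unique {h = h} run = unique-keys h (permutation⇒unique (history-permutation run))
    where
    unique-keys : ∀ {e t₁ t₂} (h : History) → Unique (map proj₁ h) →
                  (e , t₁) ∈ₗ h → (e , t₂) ∈ₗ h → t₁ ≡ t₂
    unique-keys _ _                (here refl) (here refl) = refl
    unique-keys _ (e∉ ∷ _)         (here refl) (there m)   = ⊥-elim (All.lookup e∉ (∈-map⁺ proj₁ m) refl)
    unique-keys _ (e∉ ∷ _)         (there m)   (here refl) = ⊥-elim (All.lookup e∉ (∈-map⁺ proj₁ m) refl)
    unique-keys (_ ∷ h) (_ ∷ uniq) (there m)   (there m′)  = unique-keys h uniq m m′

  hasType⇒∈ : ∀ {S h e t} → HistoryOf G Δ S h → HasType G Δ S e t → (e , t) ∈ₗ h
  hasType⇒∈ {e = e} {t} run (_ , run′ , m) = subst ((e , t) ∈ₗ_) (run-unique run′ run) m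

  active⇒L⊎I : ∀ {S h e t} → HistoryOf G Δ S h → (e , t) ∈ₗ h → InAct G Δ S e → t ≡ L ⊎ t ≡ I
  active⇒L⊎I run m (inj₁ hasL) = inj₁ (type-unique run m (hasType⇒∈ run hasL))
  active⇒L⊎I run m (inj₂ hasI) = inj₂ (type-unique run m (hasType⇒∈ run hasI))

∈─⁻ : ∀ {n} {x : Fin n} (p q : Subset n) → x ∈ p ─ q → x ∈ p × x ∉ q
∈─⁻ (inside ∷ p) (outside ∷ q) here = here , λ ()
∈─⁻ {x = zero} (outside ∷ p) (outside ∷ q) ()
∈─⁻ {x = zero} (_ ∷ p) (inside ∷ q) ()
∈─⁻ (_ ∷ p) (_ ∷ q) (there m) with ∈─⁻ p q m
... | x∈p , x∉q = there x∈p , λ { (there x∈q) → x∉q x∈q }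

∈△⁻ : ∀ {n} {x : Fin n} (S T : Subset n) → x ∈ S △ T → (x ∈ S × x ∉ T) ⊎ (x ∈ T × x ∉ S)
∈△⁻ S T m with x∈p∪q⁻ (S ─ T) (T ─ S) m
... | inj₁ m′ = inj₁ (∈─⁻ S T m′)
... | inj₂ m′ = inj₂ (∈─⁻ T S m′)

∈△⁺ˡ : ∀ {n} {x : Fin n} {S T : Subset n} → x ∈ S → x ∉ T → x ∈ S △ T
∈△⁺ˡ x∈S x∉T = x∈p∪q⁺ (inj₁ (x∈p∧x∉q⇒x∈p─q x∈S x∉T))

∈△⁺ʳ : ∀ {n} {x : Fin n} {S T : Subset n} → x ∈ T → x ∉ S → x ∈ S △ T
∈△⁺ʳ x∈T x∉S = x∈p∪q⁺ (inj₂ (x∈p∧x∉q⇒x∈p─q x∈T x∉S))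

△-cancelˡ : ∀ {n} (S R : Subset n) → S △ (S △ R) ≡ R
△-cancelˡ [] [] = refl
△-cancelˡ (true  ∷ S) (true  ∷ R) = cong (true  ∷_) (△-cancelˡ S R)
△-cancelˡ (true  ∷ S) (false ∷ R) = cong (false ∷_) (△-cancelˡ S R)
△-cancelˡ (false ∷ S) (true  ∷ R) = cong (true  ∷_) (△-cancelˡ S R)
△-cancelˡ (false ∷ S) (false ∷ R) = cong (false ∷_) (△-cancelˡ S R)

module Characterisation (G : Graph) (Δ : BTree (nE G) (nE G)) (isDT : IsDecisionTree G Δ)
                        (S S′ : Subset (nE G)) where

  open Runs G
  open Histories G Δ isDT

  SameHistory : Set
  SameHistory = ∃ λ h → HistoryOf G Δ S h × HistoryOf G Δ S′ h

  sameHistory⇒sameTypes : SameHistory → ∀ e t → HasType G Δ S e t ⇔ HasType G Δ S′ e t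
  sameHistory⇒sameTypes (h , run , run′) e t = mk⇔
    (λ hasT → h , run′ , hasType⇒∈ run hasT)
    (λ hasT → h , run , hasType⇒∈ run′ hasT)

  keepsSeSi⇒sameHistory : (∀ e → HasType G Δ S e Se → HasType G Δ S′ e Se) →
                          (∀ e → HasType G Δ S e Si → HasType G Δ S′ e Si) → SameHistory
  keepsSeSi⇒sameHistory keepSe keepSi =
    let h , run = history-exists S
    in h , run , run-transfer run
         (λ e m → let _ , run′ , m′ = keepSe e (h , run , m) in Se⇒∉ run′ m′)
         (λ e m → let _ , run′ , m′ = keepSi e (h , run , m) in Si⇒∈ run′ m′)

  -- edges in S △ S′ are not of type Se or Si, hence active
  sameHistory⇒△⊆Act : SameHistory → ∀ e → e ∈ S △ S′ → InAct G Δ S e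
  sameHistory⇒△⊆Act (h , run , run′) e e∈△ with type-exists run e | ∈△⁻ S S′ e∈△
  ... | Se , m | inj₁ (e∈S , _)   = ⊥-elim (Se⇒∉ run m e∈S)
  ... | Se , m | inj₂ (e∈S′ , _)  = ⊥-elim (Se⇒∉ run′ m e∈S′)
  ... | Si , m | inj₁ (_ , e∉S′)  = ⊥-elim (e∉S′ (Si⇒∈ run′ m))
  ... | Si , m | inj₂ (_ , e∉S)   = ⊥-elim (e∉S (Si⇒∈ run m))
  ... | L  , m | _                = inj₁ (h , run , m)
  ... | I  , m | _                = inj₂ (h , run , m)

  △⊆Act⇒sameHistory : (∀ e → e ∈ S △ S′ → InAct G Δ S e) → SameHistory
  △⊆Act⇒sameHistory △⊆Act =
    let h , run = history-exists S
    in h , run , run-transfer run (Se-stays run) (Si-stays run)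
    where
    toggled⇒L⊎I : ∀ {h e t} → HistoryOf G Δ S h → (e , t) ∈ₗ h → e ∈ S △ S′ → t ≡ L ⊎ t ≡ I
    toggled⇒L⊎I run m e∈△ = active⇒L⊎I run m (△⊆Act _ e∈△)
    Se-stays : ∀ {h} → HistoryOf G Δ S h → ∀ e → (e , Se) ∈ₗ h → e ∉ S′
    Se-stays run e m e∈S′ with toggled⇒L⊎I run m (∈△⁺ʳ e∈S′ (Se⇒∉ run m))
    ... | inj₁ ()
    ... | inj₂ ()
    Si-stays : ∀ {h} → HistoryOf G Δ S h → ∀ e → (e , Si) ∈ₗ h → e ∈ S′
    Si-stays run e m with e ∈? S′
    ... | yes e∈S′ = e∈S′
    ... | no  e∉S′ with toggled⇒L⊎I run m (∈△⁺ˡ (Si⇒∈ run m) e∉S′)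
    ... | inj₁ ()
    ... | inj₂ ()

-- Proposition 6.1.

proposition6p1 : (G : Graph) → ConnectedGraph G → nE G ≥ 1 →
    (Δ : BTree (nE G) (nE G)) → IsDecisionTree G Δ →
    (S S' : Subset (nE G)) →
    let
      cI   = Σ _ λ h → HistoryOf G Δ S h × HistoryOf G Δ S' h
      cII  = ∀ e t → HasType G Δ S e t ⇔ HasType G Δ S' e t
      cIII = ∀ e → (HasType G Δ S e Se ⇔ HasType G Δ S' e Se)
                 × (HasType G Δ S e Si ⇔ HasType G Δ S' e Si)
      cIV  = ∀ e → e ∈ (S △ S') → InAct G Δ S e
      cV   = Σ (Subset (nE G)) λ R → (∀ e → e ∈ R → InAct G Δ S e) × (S' ≡ S △ R)
    in (cI ⇔ cII) × (cI ⇔ cIII) × (cI ⇔ cIV) × (cI ⇔ cV)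
proposition6p1 G _ _ Δ isDT S S' =
    mk⇔ sameHistory⇒sameTypes
        (λ same → keepsSeSi⇒sameHistory (λ e → to (same e Se)) (λ e → to (same e Si)))
  , mk⇔ (λ h e → sameHistory⇒sameTypes h e Se , sameHistory⇒sameTypes h e Si)
        (λ same → keepsSeSi⇒sameHistory (λ e → to (proj₁ (same e))) (λ e → to (proj₂ (same e))))
  , mk⇔ sameHistory⇒△⊆Act △⊆Act⇒sameHistory
  , mk⇔ (λ h → S △ S' , sameHistory⇒△⊆Act h , sym (△-cancelˡ S S'))
        (λ { (R , R⊆Act , refl) →
               △⊆Act⇒sameHistory (λ e e∈△ → R⊆Act e (subst (e ∈_) (△-cancelˡ S R) e∈△)) })
  where open Characterisation G Δ isDT S S'
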